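{- For every positive integer $n$, let $\mathbf C_n$ denote the $n$-element chain, equipped with its unique antitone involution $'$ (so that $(C_n,\vee,\wedge,{}')$ is a Kleene lattice). Then \[(C_n,\vee,\wedge,{}')\cong\big(P_S(\mathbf C_{\lfloor n/2\rfloor+1}),\sqcup,\sqcap,{}'\big)\] where $S$ consists of the smallest element of $\mathbf C_{\lfloor n/2\rfloor+1}$ if $n$ is odd, and $S$ consists of the two smallest elements of $\mathbf C_{\lfloor n/2\rfloor+1}$ if $n$ is even.
   Context: For a lattice $\mathbf L$ and non-empty $S\subseteq L$, $P_S(\mathbf L):=\{(x,y)\in L^2\mid x\wedge y\leq z\leq x\vee y\text{ for all }z\in S\}$, with $(x,y)\sqcup(z,v):=(x\vee z,y\wedge v)$, $(x,y)\sqcap(z,v):=(x\wedge z,y\vee v)$ and $(x,y)':=(y,x)$. A Kleene lattice is a distributive lattice with an antitone involution $'$ satisfying $x\wedge x'\leq y\vee y'$. -}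

module Defs where

open import Data.Nat as ℕ using (ℕ; _%_; _/_; _∸_)
open import Data.Fin using (Fin; toℕ; opposite; _≤_; _<_)
open import Data.Fin.Properties using (_≤?_)
open import Data.Product using (Σ; _×_; _,_; proj₁)
open import Relation.Binary.PropositionalEquality using (_≡_)
open import Relation.Nullary using (yes; no)

_∨_ : ∀ {n} → Fin n → Fin n → Fin n
i ∨ j with i ≤? j
... | yes _ = j
... | no  _ = i

_∧_ : ∀ {n} → Fin n → Fin n → Fin n
i ∧ j with i ≤? j
... | yes _ = i
... | no  _ = j

_′ : ∀ {n} → Fin n → Fin n
i ′ = opposite i

InP : ∀ {m} → (S : Fin m → Set) → Fin m × Fin m → Set
InP S (x , y) = ∀ z → S z → ((x ∧ y) ≤ z) × (z ≤ (x ∨ y))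

PS : ∀ {m} → (S : Fin m → Set) → Set
PS {m} S = Σ (Fin m × Fin m) (InP S)

-- Operations on pairs (P_S is closed under them; we state them on L²).
_⊔ₚ_ : ∀ {m} → Fin m × Fin m → Fin m × Fin m → Fin m × Fin m
(x , y) ⊔ₚ (z , v) = (x ∨ z , y ∧ v)

_⊓ₚ_ : ∀ {m} → Fin m × Fin m → Fin m × Fin m → Fin m × Fin m
(x , y) ⊓ₚ (z , v) = (x ∧ z , y ∨ v)

_′ₚ : ∀ {m} → Fin m × Fin m → Fin m × Fin m
(x , y) ′ₚ = (y , x)

half+1 : ℕ → ℕ
half+1 n = ℕ.suc (n / 2)

-- S_n ⊆ C_{⌊n/2⌋+1}: the smallest element if n is odd, the two smallest
-- elements if n is even (i.e. elements with index < 2 ∸ (n % 2)).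
Sₙ : (n : ℕ) → Fin (half+1 n) → Set
Sₙ n z = ℕ._<_ (toℕ z) (2 ∸ (n % 2))

-- An isomorphism of algebras (C_n, ∨, ∧, ′) ≅ (P_S(C_m), ⊔, ⊓, ′),
-- with equality on P_S taken to be equality of the underlying pairs.
record KleeneIso (n : ℕ) : Set where
  field
    to      : Fin n → PS (Sₙ n)
    from    : PS (Sₙ n) → Fin n
    from∘to : ∀ x → from (to x) ≡ x
    to∘from : ∀ p → proj₁ (to (from p)) ≡ proj₁ p
    pres-∨  : ∀ x y → proj₁ (to (x ∨ y)) ≡ (proj₁ (to x) ⊔ₚ proj₁ (to y))
    pres-∧  : ∀ x y → proj₁ (to (x ∧ y)) ≡ (proj₁ (to x) ⊓ₚ proj₁ (to y))
    pres-′  : ∀ x → proj₁ (to (x ′)) ≡ (proj₁ (to x)) ′ₚ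

-- Write h = ⌊n/2⌋ and n = h + d + 1, so that d = h for odd n and d = h − 1 for
-- even n.  Send i ∈ C_n to the pair (i ∸ d , h ∸ i) in C_{h+1}²: the chain is
-- folded at its middle, its upper part [d, h + d] being read upwards in the
-- first coordinate and its lower part [0, h] downwards in the second.  Truncated
-- subtraction is monotone in one argument and antitone in the other, so joins
-- and meets go to ⊔ and ⊓ of pairs, and the involution i ↦ h + d − i swaps the
-- two coordinates.  The image consists of the pairs whose meet is 0 and, when
-- n is even, whose join is at least 1; this is exactly membership in P_S.
module Submission where

open import Defs
open import Data.Nat using (ℕ; zero; suc; _+_; _*_; _∸_; _⊔_; _⊓_; _<_; _≤_; _%_; _/_; z≤n; s≤s; s≤s⁻¹; NonZero)
open import Data.Nat.Properties
open import Data.Nat.DivMod using (m≡m%n+[m/n]*n; m%n<n; m/n<m)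
open import Data.Fin as Fin using (Fin; toℕ; fromℕ<; opposite)
open import Data.Fin.Properties using (toℕ-injective; toℕ-fromℕ<; toℕ<n; opposite-prop)
open import Data.Product using (_×_; _,_; proj₁; proj₂; map; swap)
open import Function.Bundles using (_⇔_; mk⇔; Equivalence)
open import Relation.Binary.PropositionalEquality
open import Relation.Nullary using (yes; no)

toℕ-∨ : ∀ {m} (i j : Fin m) → toℕ (i ∨ j) ≡ toℕ i ⊔ toℕ j
toℕ-∨ i j with i Fin.≤? j
... | yes i≤j = sym (m≤n⇒m⊔n≡n i≤j)
... | no  i≰j = sym (m≥n⇒m⊔n≡m (<⇒≤ (≰⇒> i≰j)))

toℕ-∧ : ∀ {m} (i j : Fin m) → toℕ (i ∧ j) ≡ toℕ i ⊓ toℕ j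
toℕ-∧ i j with i Fin.≤? j
... | yes i≤j = sym (m≤n⇒m⊓n≡m i≤j)
... | no  i≰j = sym (m≥n⇒m⊓n≡n (<⇒≤ (≰⇒> i≰j)))

toℕ² : ∀ {m} → Fin m × Fin m → ℕ × ℕ
toℕ² = map toℕ toℕ

toℕ²-injective : ∀ {m} {p q : Fin m × Fin m} → toℕ² p ≡ toℕ² q → p ≡ q
toℕ²-injective eq = cong₂ _,_ (toℕ-injective (cong proj₁ eq)) (toℕ-injective (cong proj₂ eq))

_⊔ₙ_ : ℕ × ℕ → ℕ × ℕ → ℕ × ℕ
(a , b) ⊔ₙ (a′ , b′) = a ⊔ a′ , b ⊓ b′

_⊓ₙ_ : ℕ × ℕ → ℕ × ℕ → ℕ × ℕ
(a , b) ⊓ₙ (a′ , b′) = a ⊓ a′ , b ⊔ b′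

toℕ²-⊔ₚ : ∀ {m} (p q : Fin m × Fin m) → toℕ² (p ⊔ₚ q) ≡ toℕ² p ⊔ₙ toℕ² q
toℕ²-⊔ₚ (x , y) (z , v) = cong₂ _,_ (toℕ-∨ x z) (toℕ-∧ y v)

toℕ²-⊓ₚ : ∀ {m} (p q : Fin m × Fin m) → toℕ² (p ⊓ₚ q) ≡ toℕ² p ⊓ₙ toℕ² q
toℕ²-⊓ₚ (x , y) (z , v) = cong₂ _,_ (toℕ-∧ x z) (toℕ-∨ y v)

-- The interval spanned by the pair contains [0, c), i.e. the pair lies in P_[0,c).
Encloses : ℕ → ℕ × ℕ → Set
Encloses c (a , b) = a ⊓ b ≡ 0 × c ≤ suc (a ⊔ b)

InP-initial⇔Encloses : ∀ {m c} → 0 < c → c ≤ m → (x y : Fin m) →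
                       InP (λ z → toℕ z < c) (x , y) ⇔ Encloses c (toℕ² (x , y))
InP-initial⇔Encloses {m} {suc k} _ c≤m x y = mk⇔ encloses inP
  where
    bottom top : Fin m
    bottom = fromℕ< (≤-trans (s≤s z≤n) c≤m)
    top    = fromℕ< c≤m

    encloses : InP (λ z → toℕ z < suc k) (x , y) → Encloses (suc k) (toℕ² (x , y))
    encloses bounds =
        n≤0⇒n≡0 (subst₂ _≤_ (toℕ-∧ x y) (toℕ-fromℕ< _) (proj₁ (bounds bottom bottom<c)))
      , s≤s (subst₂ _≤_ (toℕ-fromℕ< c≤m) (toℕ-∨ x y) (proj₂ (bounds top top<c)))
      where
        bottom<c : toℕ bottom < suc k
        bottom<c = subst (_< suc k) (sym (toℕ-fromℕ< _)) (s≤s z≤n)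
        top<c : toℕ top < suc k
        top<c = subst (_< suc k) (sym (toℕ-fromℕ< c≤m)) ≤-refl

    inP : Encloses (suc k) (toℕ² (x , y)) → InP (λ z → toℕ z < suc k) (x , y)
    inP (meet≡0 , k≤join) z z<c =
        subst (_≤ toℕ z) (sym (trans (toℕ-∧ x y) meet≡0)) z≤n
      , subst (toℕ z ≤_) (sym (toℕ-∨ x y)) (s≤s⁻¹ (≤-trans z<c k≤join))

fold : ℕ → ℕ → ℕ → ℕ × ℕ
fold h d i = i ∸ d , h ∸ i

unfold : ℕ → ℕ → ℕ × ℕ → ℕ
unfold h d (a , zero)  = a + d
unfold h d (_ , suc b) = h ∸ suc b

unfold-positive : ∀ {h d a b} → 0 < b → unfold h d (a , b) ≡ h ∸ b
unfold-positive {b = suc _} _ = refl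

unfold-≤ : ∀ {h d a} b → a ≤ h → unfold h d (a , b) ≤ h + d
unfold-≤ {d = d} zero    a≤h = +-monoˡ-≤ d a≤h
unfold-≤ {h} {d} (suc b) _   = ≤-trans (m∸n≤m h (suc b)) (m≤m+n h d)

unfold-fold : ∀ {h d} → d ≤ h → ∀ i → unfold h d (fold h d i) ≡ i
unfold-fold {h} {d} d≤h i with i <? h
... | yes i<h = begin
  unfold h d (i ∸ d , h ∸ i) ≡⟨ unfold-positive (m<n⇒0<n∸m i<h) ⟩
  h ∸ (h ∸ i)                ≡⟨ m∸[m∸n]≡n (<⇒≤ i<h) ⟩
  i                          ∎
  where open ≡-Reasoning
... | no i≮h rewrite m≤n⇒m∸n≡0 (≮⇒≥ i≮h) = m∸n+n≡m (≤-trans d≤h (≮⇒≥ i≮h))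

fold-unfold : ∀ {h d a b} → a ⊓ b ≡ 0 → b ≤ h → h ≤ (a ⊔ b) + d →
              fold h d (unfold h d (a , b)) ≡ (a , b)
fold-unfold {h} {d} {a} {zero} _ _ h≤a+d =
  cong₂ _,_ (m+n∸n≡m a d) (m≤n⇒m∸n≡0 (subst (λ t → h ≤ t + d) (⊔-identityʳ a) h≤a+d))
fold-unfold {h} {d} {zero} {suc b} _ b≤h h≤b+d =
  cong₂ _,_ (m≤n⇒m∸n≡0 (m≤n+o⇒m∸n≤o h (suc b) h≤b+d)) (m∸[m∸n]≡n b≤h)

fold-meet≡0 : ∀ {h d} → h ≤ suc d → ∀ i → (i ∸ d) ⊓ (h ∸ i) ≡ 0
fold-meet≡0 {h} {d} h≤1+d i with i ≤? d
... | yes i≤d rewrite m≤n⇒m∸n≡0 i≤d = refl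
... | no  i≰d rewrite m≤n⇒m∸n≡0 (≤-trans h≤1+d (≰⇒> i≰d)) = ⊓-zeroʳ (i ∸ d)

fold-join-reaches : ∀ {h d} → h ≤ suc d → ∀ i → h ≤ ((i ∸ d) ⊔ (h ∸ i)) + d
fold-join-reaches {h} {d} h≤1+d i with i ≤? d
... | yes i≤d = begin
  h                         ≤⟨ m≤n+m∸n h i ⟩
  i + (h ∸ i)               ≤⟨ +-monoˡ-≤ (h ∸ i) i≤d ⟩
  d + (h ∸ i)               ≡⟨ +-comm d (h ∸ i) ⟩
  (h ∸ i) + d               ≤⟨ +-monoˡ-≤ d (m≤n⊔m (i ∸ d) (h ∸ i)) ⟩
  ((i ∸ d) ⊔ (h ∸ i)) + d   ∎
  where open ≤-Reasoning
... | no i≰d = begin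
  h                         ≤⟨ h≤1+d ⟩
  suc d                     ≤⟨ ≰⇒> i≰d ⟩
  i                         ≤⟨ m≤n+m∸n i d ⟩
  d + (i ∸ d)               ≡⟨ +-comm d (i ∸ d) ⟩
  (i ∸ d) + d               ≤⟨ +-monoˡ-≤ d (m≤m⊔n (i ∸ d) (h ∸ i)) ⟩
  ((i ∸ d) ⊔ (h ∸ i)) + d   ∎
  where open ≤-Reasoning

fold-⊔ : ∀ h d i j → fold h d (i ⊔ j) ≡ fold h d i ⊔ₙ fold h d j
fold-⊔ h d i j = cong₂ _,_ (∸-distribʳ-⊔ d i j) (∸-distribˡ-⊔-⊓ h i j)

fold-⊓ : ∀ h d i j → fold h d (i ⊓ j) ≡ fold h d i ⊓ₙ fold h d j
fold-⊓ h d i j = cong₂ _,_ (∸-distribʳ-⊓ d i j) (∸-distribˡ-⊓-⊔ h i j)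

[h+d∸i]∸d≡h∸i : ∀ h d i → (h + d ∸ i) ∸ d ≡ h ∸ i
[h+d∸i]∸d≡h∸i h d i = begin
  (h + d ∸ i) ∸ d   ≡⟨ ∸-+-assoc (h + d) i d ⟩
  h + d ∸ (i + d)   ≡⟨ cong₂ _∸_ (+-comm h d) (+-comm i d) ⟩
  d + h ∸ (d + i)   ≡⟨ [m+n]∸[m+o]≡n∸o d h i ⟩
  h ∸ i             ∎
  where open ≡-Reasoning

fold-reflect : ∀ {h d i} → i ≤ h + d → fold h d (h + d ∸ i) ≡ swap (fold h d i)
fold-reflect {h} {d} {i} i≤h+d = cong₂ _,_ ([h+d∸i]∸d≡h∸i h d i) (begin
  h ∸ (h + d ∸ i)                   ≡⟨ sym ([h+d∸i]∸d≡h∸i h d (h + d ∸ i)) ⟩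
  (h + d ∸ (h + d ∸ i)) ∸ d         ≡⟨ cong (_∸ d) (m∸[m∸n]≡n i≤h+d) ⟩
  i ∸ d                             ∎)
  where open ≡-Reasoning

module Folding {n h d c : ℕ} (n≡1+h+d : n ≡ suc (h + d)) (c+d≡1+h : c + d ≡ suc h)
               (0<c : 0 < c) (c≤2 : c ≤ 2) where

  open ≡-Reasoning

  S : Fin (suc h) → Set
  S z = toℕ z < c

  d≤h : d ≤ h
  d≤h = s≤s⁻¹ (subst (suc d ≤_) c+d≡1+h (+-monoˡ-≤ d 0<c))

  h≤1+d : h ≤ suc d
  h≤1+d = s≤s⁻¹ (subst (_≤ 2 + d) c+d≡1+h (+-monoˡ-≤ d c≤2))

  c≤1+h : c ≤ suc h
  c≤1+h = subst (c ≤_) c+d≡1+h (m≤m+n c d)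

  encloses⇔reaches : ∀ s → c ≤ suc s ⇔ h ≤ s + d
  encloses⇔reaches s = mk⇔
    (λ c≤1+s → s≤s⁻¹ (subst (_≤ suc s + d) c+d≡1+h (+-monoˡ-≤ d c≤1+s)))
    (λ h≤s+d → +-cancelʳ-≤ d c (suc s) (subst (_≤ suc s + d) (sym c+d≡1+h) (s≤s h≤s+d)))

  InP⇔Encloses : (x y : Fin (suc h)) → InP S (x , y) ⇔ Encloses c (toℕ² (x , y))
  InP⇔Encloses = InP-initial⇔Encloses 0<c c≤1+h

  fold-encloses : ∀ i → Encloses c (fold h d i)
  fold-encloses i = fold-meet≡0 h≤1+d i
                  , Equivalence.from (encloses⇔reaches _) (fold-join-reaches h≤1+d i)

  fold-unfold-enclosed : ∀ {a b} → b ≤ h → Encloses c (a , b) → fold h d (unfold h d (a , b)) ≡ (a , b)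
  fold-unfold-enclosed b≤h (meet≡0 , c≤1+join) =
    fold-unfold meet≡0 b≤h (Equivalence.to (encloses⇔reaches _) c≤1+join)

  toℕ≤h+d : (i : Fin n) → toℕ i ≤ h + d
  toℕ≤h+d i = s≤s⁻¹ (subst (toℕ i <_) n≡1+h+d (toℕ<n i))

  toPair : Fin n → Fin (suc h) × Fin (suc h)
  toPair i = fromℕ< (s≤s (m≤n+o⇒m∸n≤o (toℕ i) d (subst (toℕ i ≤_) (+-comm h d) (toℕ≤h+d i))))
           , fromℕ< (s≤s (m∸n≤m h (toℕ i)))

  toℕ²-toPair : ∀ i → toℕ² (toPair i) ≡ fold h d (toℕ i)
  toℕ²-toPair i = cong₂ _,_ (toℕ-fromℕ< _) (toℕ-fromℕ< _)

  to : Fin n → PS S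
  to i = toPair i , Equivalence.from (InP⇔Encloses _ _)
                      (subst (Encloses c) (sym (toℕ²-toPair i)) (fold-encloses (toℕ i)))

  fromℕ≤h+d : ∀ {i} → i ≤ h + d → Fin n
  fromℕ≤h+d {i} i≤h+d = fromℕ< (subst (i <_) (sym n≡1+h+d) (s≤s i≤h+d))

  from : PS S → Fin n
  from ((a , b) , _) = fromℕ≤h+d (unfold-≤ (toℕ b) (s≤s⁻¹ (toℕ<n a)))

  toℕ-from : ∀ p → toℕ (from p) ≡ unfold h d (toℕ² (proj₁ p))
  toℕ-from ((a , b) , _) = toℕ-fromℕ< _

  from∘to : ∀ x → from (to x) ≡ x
  from∘to x = toℕ-injective (begin
    toℕ (from (to x))              ≡⟨ toℕ-from (to x) ⟩
    unfold h d (toℕ² (toPair x))   ≡⟨ cong (unfold h d) (toℕ²-toPair x) ⟩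
    unfold h d (fold h d (toℕ x))  ≡⟨ unfold-fold d≤h (toℕ x) ⟩
    toℕ x                          ∎)

  to∘from : ∀ p → proj₁ (to (from p)) ≡ proj₁ p
  to∘from p@((a , b) , a,b∈P) = toℕ²-injective (begin
    toℕ² (toPair (from p))           ≡⟨ toℕ²-toPair (from p) ⟩
    fold h d (toℕ (from p))          ≡⟨ cong (fold h d) (toℕ-from p) ⟩
    fold h d (unfold h d (toℕ² (a , b)))
      ≡⟨ fold-unfold-enclosed (s≤s⁻¹ (toℕ<n b)) (Equivalence.to (InP⇔Encloses a b) a,b∈P) ⟩
    toℕ² (a , b)                     ∎)

  pres-∨ : ∀ x y → proj₁ (to (x ∨ y)) ≡ (proj₁ (to x) ⊔ₚ proj₁ (to y))
  pres-∨ x y = toℕ²-injective (begin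
    toℕ² (toPair (x ∨ y))                         ≡⟨ toℕ²-toPair (x ∨ y) ⟩
    fold h d (toℕ (x ∨ y))                        ≡⟨ cong (fold h d) (toℕ-∨ x y) ⟩
    fold h d (toℕ x ⊔ toℕ y)                      ≡⟨ fold-⊔ h d (toℕ x) (toℕ y) ⟩
    fold h d (toℕ x) ⊔ₙ fold h d (toℕ y)          ≡⟨ sym (cong₂ _⊔ₙ_ (toℕ²-toPair x) (toℕ²-toPair y)) ⟩
    toℕ² (toPair x) ⊔ₙ toℕ² (toPair y)            ≡⟨ sym (toℕ²-⊔ₚ (toPair x) (toPair y)) ⟩
    toℕ² (toPair x ⊔ₚ toPair y)                   ∎)

  pres-∧ : ∀ x y → proj₁ (to (x ∧ y)) ≡ (proj₁ (to x) ⊓ₚ proj₁ (to y))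
  pres-∧ x y = toℕ²-injective (begin
    toℕ² (toPair (x ∧ y))                         ≡⟨ toℕ²-toPair (x ∧ y) ⟩
    fold h d (toℕ (x ∧ y))                        ≡⟨ cong (fold h d) (toℕ-∧ x y) ⟩
    fold h d (toℕ x ⊓ toℕ y)                      ≡⟨ fold-⊓ h d (toℕ x) (toℕ y) ⟩
    fold h d (toℕ x) ⊓ₙ fold h d (toℕ y)          ≡⟨ sym (cong₂ _⊓ₙ_ (toℕ²-toPair x) (toℕ²-toPair y)) ⟩
    toℕ² (toPair x) ⊓ₙ toℕ² (toPair y)            ≡⟨ sym (toℕ²-⊓ₚ (toPair x) (toPair y)) ⟩
    toℕ² (toPair x ⊓ₚ toPair y)                   ∎)

  pres-′ : ∀ x → proj₁ (to (x ′)) ≡ (proj₁ (to x)) ′ₚ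
  pres-′ x = toℕ²-injective (begin
    toℕ² (toPair (x ′))                    ≡⟨ toℕ²-toPair (x ′) ⟩
    fold h d (toℕ (opposite x))            ≡⟨ cong (fold h d) (opposite-prop x) ⟩
    fold h d (n ∸ suc (toℕ x))             ≡⟨ cong (λ m → fold h d (m ∸ suc (toℕ x))) n≡1+h+d ⟩
    fold h d (h + d ∸ toℕ x)               ≡⟨ fold-reflect (toℕ≤h+d x) ⟩
    swap (fold h d (toℕ x))                ≡⟨ cong swap (sym (toℕ²-toPair x)) ⟩
    toℕ² (toPair x ′ₚ)                     ∎)

module Halving (n : ℕ) .{{_ : NonZero n}} where

  open ≡-Reasoning

  h d c : ℕ
  h = n / 2
  d = n ∸ suc h
  c = 2 ∸ n % 2

  h<n : h < n
  h<n = m/n<m n 2 (s≤s (s≤s z≤n))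

  n≡1+h+d : n ≡ suc (h + d)
  n≡1+h+d = sym (m+[n∸m]≡n h<n)

  c+d≡1+h : c + d ≡ suc h
  c+d≡1+h = +-cancelʳ-≡ (suc h) (c + d) (suc h) (begin
    (c + d) + suc h        ≡⟨ +-assoc c d (suc h) ⟩
    c + (d + suc h)        ≡⟨ cong (c +_) (m∸n+n≡m h<n) ⟩
    c + n                  ≡⟨ cong (c +_) (m≡m%n+[m/n]*n n 2) ⟩
    c + (n % 2 + h * 2)    ≡⟨ sym (+-assoc c (n % 2) (h * 2)) ⟩
    (c + n % 2) + h * 2    ≡⟨ cong₂ _+_ (m∸n+n≡m (<⇒≤ (m%n<n n 2))) (*-comm h 2) ⟩
    2 + (h + (h + 0))      ≡⟨ cong (λ t → 2 + (h + t)) (+-identityʳ h) ⟩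
    2 + (h + h)            ≡⟨ cong suc (sym (+-suc h h)) ⟩
    suc h + suc h          ∎)

  0<c : 0 < c
  0<c = m<n⇒0<n∸m (m%n<n n 2)

  c≤2 : c ≤ 2
  c≤2 = m∸n≤m 2 (n % 2)

corollary21 : (n : ℕ) → 1 ≤ n → KleeneIso n
corollary21 n@(suc _) _ = record
  { to = to ; from = from ; from∘to = from∘to ; to∘from = to∘from
  ; pres-∨ = pres-∨ ; pres-∧ = pres-∧ ; pres-′ = pres-′ }
  where
    open Halving n
    open Folding n≡1+h+d c+d≡1+h 0<c c≤2
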